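{- Let $\mathbb{K}=(G,M,I,\preceq)$ be an extended formal context whose partial order is valid, i.e. $\underline{A'}=(\underline{A'})''$ for every $A\subseteq M$. Then the meet (greatest common sub-concept) in the concept lattice of $(G,M,I)$ of any two typical concepts of $\mathbb{K}$ is itself a typical concept. Hence the set of typical concepts forms a $\wedge$-subsemilattice of the concept lattice.
   Context: An extended formal context is $(G,M,I,\preceq)$ with $G$ a finite non-empty set of objects, $M$ a finite non-empty set of attributes, $I\subseteq G\times M$, and $\preceq$ a partial order on $G$ with strict part $\prec$. Derivation: for $B\subseteq M$, $B'=\{g\in G\mid\forall m\in B,\ (g,m)\in I\}$; for $A\subseteq G$, $A'=\{m\in M\mid\forall g\in A,\ (g,m)\in I\}$. A formal concept is a pair $(A,B)$ with $A'=B$, $B'=A$; concepts are ordered by $(A_1,B_1)\le(A_2,B_2)$ iff $A_1\subseteq A_2$, forming the concept lattice, in which the meet is $(A_1,B_1)\wedge(A_2,B_2)=(A_1\cap A_2,(B_1\cup B_2)'')$. Minimised derivation: $\underline{B'}=\{g\in B'\mid\nexists h\in B'\text{ with } h\prec g\}$. A typical concept is a pair $\big((\underline{X'})'',(\underline{X'})'\big)$ for some $X\subseteq M$. -}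

module Defs where

open import Data.Bool using (Bool; true; false; _∧_; _∨_; not)
open import Data.Nat using (ℕ; zero; suc)
open import Data.Fin using (Fin; zero; suc; _≟_)
open import Data.Fin.Subset using (Subset; _∩_; _∪_; _∈_)
open import Data.Vec using (tabulate; lookup)
open import Data.Product using (Σ; ∃; _×_; _,_)
open import Relation.Binary.PropositionalEquality using (_≡_)
open import Relation.Binary.Structures using (IsPartialOrder)
open import Relation.Nullary.Decidable using (⌊_⌋)

allF : ∀ {n} → (Fin n → Bool) → Bool
allF {zero}  p = true
allF {suc n} p = p zero ∧ allF (λ i → p (suc i))

anyF : ∀ {n} → (Fin n → Bool) → Bool
anyF {zero}  p = false
anyF {suc n} p = p zero ∨ anyF (λ i → p (suc i))

_⇒b_ : Bool → Bool → Bool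
a ⇒b b = not a ∨ b

mem : ∀ {n} → Fin n → Subset n → Bool
mem i S = lookup S i

record ExtContext (n k : ℕ) : Set where
  field
    I      : Fin (suc n) → Fin (suc k) → Bool
    le     : Fin (suc n) → Fin (suc n) → Bool
    isPO   : IsPartialOrder {A = Fin (suc n)} _≡_ (λ g h → le g h ≡ true)

  G = Fin (suc n)
  M = Fin (suc k)

  lt : G → G → Bool
  lt h g = le h g ∧ not ⌊ h ≟ g ⌋

  extent : Subset (suc k) → Subset (suc n)
  extent B = tabulate λ g → allF λ m → mem m B ⇒b I g m

  intent : Subset (suc n) → Subset (suc k)
  intent A = tabulate λ m → allF λ g → mem g A ⇒b I g m

  minExtent : Subset (suc k) → Subset (suc n)
  minExtent B = tabulate λ g →
    mem g (extent B) ∧ not (anyF λ h → mem h (extent B) ∧ lt h g)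

  IsConcept : Subset (suc n) → Subset (suc k) → Set
  IsConcept A B = intent A ≡ B × extent B ≡ A

  meet : (Subset (suc n) × Subset (suc k)) → (Subset (suc n) × Subset (suc k))
       → (Subset (suc n) × Subset (suc k))
  meet (A₁ , B₁) (A₂ , B₂) = (A₁ ∩ A₂ , intent (extent (B₁ ∪ B₂)))

  typicalOf : Subset (suc k) → Subset (suc n) × Subset (suc k)
  typicalOf X = (extent (intent (minExtent X)) , intent (minExtent X))

  IsTypical : Subset (suc n) × Subset (suc k) → Set
  IsTypical C = ∃ λ X → typicalOf X ≡ C

  Valid : Set
  Valid = ∀ (X : Subset (suc k)) → minExtent X ≡ extent (intent (minExtent X))

{-# OPTIONS --safe #-}

-- For a valid order the extent of the typical concept generated by X is
-- min X′ itself, an antichain. For the meet of two typical concepts with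
-- intents B₁, B₂ take Y = B₁ ∪ B₂: its extent Y′ = B₁′ ∩ B₂′ lies inside the
-- antichain min X₁′, so all of Y′ is minimal, min Y′ = Y′, and the typical
-- concept generated by Y is the ordinary concept (Y′, Y″), which is the meet.

module Submission where

open import Defs
open import Data.Bool using (Bool; true; false; _∧_; not)
open import Data.Bool.Properties using (∨-zeroʳ)
open import Data.Fin using (Fin; zero; suc)
open import Data.Fin.Subset using (Subset; _∈_; _⊆_; _∩_; _∪_)
open import Data.Fin.Subset.Properties
  using (⊆-antisym; ⊆-trans; ⊆-reflexive; p∩q⊆p; p⊆p∪q; q⊆p∪q; x∈p∩q⁺; x∈p∩q⁻; x∈p∪q⁻)
open import Data.Nat using (ℕ; zero; suc)
open import Data.Product using (_×_; _,_; ∃; proj₁; proj₂)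
open import Data.Sum using ([_,_])
open import Data.Vec using (tabulate; lookup)
open import Data.Vec.Properties using (lookup∘tabulate; lookup⇒[]=; []=⇒lookup)
open import Function using (_∘_)
open import Relation.Nullary using (¬_; contradiction)
open import Relation.Binary.PropositionalEquality using (_≡_; refl; sym; trans; cong)
open Relation.Binary.PropositionalEquality.≡-Reasoning

⇒b⁺ : ∀ {a b} → (a ≡ true → b ≡ true) → (a ⇒b b) ≡ true
⇒b⁺ {false} _ = refl
⇒b⁺ {true}  h = h refl

⇒b⁻ : ∀ {a b} → (a ⇒b b) ≡ true → a ≡ true → b ≡ true
⇒b⁻ {true} e refl = e

not≡true⁺ : ∀ {a} → ¬ (a ≡ true) → not a ≡ true
not≡true⁺ {false} _       = refl
not≡true⁺ {true}  a≢true = contradiction refl a≢true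

not≡true⁻ : ∀ {a} → not a ≡ true → ¬ (a ≡ true)
not≡true⁻ {true} ()

∧≡true⁺ : ∀ {a b} → a ≡ true → b ≡ true → a ∧ b ≡ true
∧≡true⁺ refl refl = refl

∧≡true⁻ : ∀ {a b} → a ∧ b ≡ true → a ≡ true × b ≡ true
∧≡true⁻ {true} b≡true = refl , b≡true

allF⁺ : ∀ {m} (p : Fin m → Bool) → (∀ i → p i ≡ true) → allF p ≡ true
allF⁺ {zero}  p _ = refl
allF⁺ {suc m} p h rewrite h zero = allF⁺ (p ∘ suc) (h ∘ suc)

allF⁻ : ∀ {m} (p : Fin m → Bool) → allF p ≡ true → ∀ i → p i ≡ true
allF⁻ {suc m} p e zero    = proj₁ (∧≡true⁻ e)
allF⁻ {suc m} p e (suc i) = allF⁻ (p ∘ suc) (proj₂ (∧≡true⁻ e)) i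

anyF⁺ : ∀ {m} (p : Fin m → Bool) i → p i ≡ true → anyF p ≡ true
anyF⁺ p zero    e rewrite e = refl
anyF⁺ p (suc i) e rewrite anyF⁺ (p ∘ suc) i e = ∨-zeroʳ (p zero)

anyF⁻ : ∀ {m} (p : Fin m → Bool) → anyF p ≡ true → ∃ λ i → p i ≡ true
anyF⁻ {suc m} p e with p zero in p0≡true
... | true  = zero , p0≡true
... | false with anyF⁻ (p ∘ suc) e
...   | i , pi≡true = suc i , pi≡true

∈-tabulate⁺ : ∀ {m} (f : Fin m → Bool) {i} → f i ≡ true → i ∈ tabulate f
∈-tabulate⁺ f {i} e = lookup⇒[]= i (tabulate f) (trans (lookup∘tabulate f i) e)

∈-tabulate⁻ : ∀ {m} (f : Fin m → Bool) {i} → i ∈ tabulate f → f i ≡ true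
∈-tabulate⁻ f {i} i∈ = trans (sym (lookup∘tabulate f i)) ([]=⇒lookup i∈)

module ContextProperties {n k : ℕ} (K : ExtContext n k) where

  open ExtContext K

  incidentIfIn : Subset (suc k) → G → M → Bool
  incidentIfIn B g m = mem m B ⇒b I g m

  incidentIfIn′ : Subset (suc n) → M → G → Bool
  incidentIfIn′ A m g = mem g A ⇒b I g m

  belowIn : Subset (suc k) → G → G → Bool
  belowIn B g h = mem h (extent B) ∧ lt h g

  ∈-extent⁺ : ∀ B {g} → (∀ {m} → m ∈ B → I g m ≡ true) → g ∈ extent B
  ∈-extent⁺ B {g} h = ∈-tabulate⁺ (allF ∘ incidentIfIn B)
    (allF⁺ (incidentIfIn B g) λ m → ⇒b⁺ (h ∘ lookup⇒[]= m B))

  ∈-extent⁻ : ∀ B {g m} → g ∈ extent B → m ∈ B → I g m ≡ true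
  ∈-extent⁻ B {g} {m} g∈B′ m∈B =
    ⇒b⁻ (allF⁻ (incidentIfIn B g)
           (∈-tabulate⁻ (allF ∘ incidentIfIn B) g∈B′) m) ([]=⇒lookup m∈B)

  ∈-intent⁺ : ∀ A {m} → (∀ {g} → g ∈ A → I g m ≡ true) → m ∈ intent A
  ∈-intent⁺ A {m} h = ∈-tabulate⁺ (allF ∘ incidentIfIn′ A)
    (allF⁺ (incidentIfIn′ A m) λ g → ⇒b⁺ (h ∘ lookup⇒[]= g A))

  ∈-intent⁻ : ∀ A {g m} → m ∈ intent A → g ∈ A → I g m ≡ true
  ∈-intent⁻ A {g} {m} m∈A′ g∈A =
    ⇒b⁻ (allF⁻ (incidentIfIn′ A m)
           (∈-tabulate⁻ (allF ∘ incidentIfIn′ A) m∈A′) g) ([]=⇒lookup g∈A)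

  extent-antitone : ∀ {B₁ B₂} → B₁ ⊆ B₂ → extent B₂ ⊆ extent B₁
  extent-antitone {B₁} {B₂} B₁⊆B₂ g∈B₂′ = ∈-extent⁺ B₁ (∈-extent⁻ B₂ g∈B₂′ ∘ B₁⊆B₂)

  ⊆-extent∘intent : ∀ A → A ⊆ extent (intent A)
  ⊆-extent∘intent A g∈A = ∈-extent⁺ (intent A) λ m∈A′ → ∈-intent⁻ A m∈A′ g∈A

  ⊆-intent∘extent : ∀ B → B ⊆ intent (extent B)
  ⊆-intent∘extent B m∈B = ∈-intent⁺ (extent B) λ g∈B′ → ∈-extent⁻ B g∈B′ m∈B

  extent∘intent∘extent≡extent : ∀ B → extent (intent (extent B)) ≡ extent B
  extent∘intent∘extent≡extent B =
    ⊆-antisym (extent-antitone (⊆-intent∘extent B)) (⊆-extent∘intent (extent B))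

  extent-∪ : ∀ B₁ B₂ → extent (B₁ ∪ B₂) ≡ extent B₁ ∩ extent B₂
  extent-∪ B₁ B₂ = ⊆-antisym
    (λ g∈ → x∈p∩q⁺ ( extent-antitone (p⊆p∪q {p = B₁} B₂) g∈
                    , extent-antitone (q⊆p∪q B₁ B₂) g∈))
    (λ g∈ → let g∈B₁′ , g∈B₂′ = x∈p∩q⁻ (extent B₁) (extent B₂) g∈ in
      ∈-extent⁺ (B₁ ∪ B₂) λ m∈ →
        [ ∈-extent⁻ B₁ g∈B₁′ , ∈-extent⁻ B₂ g∈B₂′ ] (x∈p∪q⁻ B₁ B₂ m∈))

  IsMinimalIn : Subset (suc n) → G → Set
  IsMinimalIn A g = ∀ {h} → h ∈ A → ¬ (lt h g ≡ true)

  ∈-minExtent⁺ : ∀ B {g} → g ∈ extent B → IsMinimalIn (extent B) g → g ∈ minExtent B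
  ∈-minExtent⁺ B {g} g∈B′ g-minimal =
    ∈-tabulate⁺ (λ g → mem g (extent B) ∧ not (anyF (belowIn B g)))
      (∧≡true⁺ ([]=⇒lookup g∈B′) (not≡true⁺ no-smaller))
    where
    no-smaller : ¬ (anyF (belowIn B g) ≡ true)
    no-smaller e with anyF⁻ (belowIn B g) e
    ... | h , h∈B′∧h≺g with ∧≡true⁻ h∈B′∧h≺g
    ...   | h∈B′ , h≺g = g-minimal (lookup⇒[]= h (extent B) h∈B′) h≺g

  ∈-minExtent⁻ : ∀ B {g} → g ∈ minExtent B → g ∈ extent B × IsMinimalIn (extent B) g
  ∈-minExtent⁻ B {g} g∈minB′ =
    let g∈B′ , no-smaller = ∧≡true⁻ {mem g (extent B)}
          (∈-tabulate⁻ (λ g → mem g (extent B) ∧ not (anyF (belowIn B g))) g∈minB′)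
    in lookup⇒[]= g (extent B) g∈B′ ,
       λ {h} h∈B′ h≺g →
         not≡true⁻ no-smaller (anyF⁺ (belowIn B g) h (∧≡true⁺ ([]=⇒lookup h∈B′) h≺g))

  minExtent⊆extent : ∀ B → minExtent B ⊆ extent B
  minExtent⊆extent B = proj₁ ∘ ∈-minExtent⁻ B

  extent⊆minExtent⇒minExtent≡extent : ∀ X Y → extent Y ⊆ minExtent X → minExtent Y ≡ extent Y
  extent⊆minExtent⇒minExtent≡extent X Y Y′⊆minX′ = ⊆-antisym (minExtent⊆extent Y) λ g∈Y′ →
    ∈-minExtent⁺ Y g∈Y′ λ h∈Y′ →
      proj₂ (∈-minExtent⁻ X (Y′⊆minX′ g∈Y′)) (minExtent⊆extent X (Y′⊆minX′ h∈Y′))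

  minExtent≡extent⇒typicalOf≡concept : ∀ Y → minExtent Y ≡ extent Y →
    typicalOf Y ≡ (extent Y , intent (extent Y))
  minExtent≡extent⇒typicalOf≡concept Y minY′≡Y′ = begin
    (extent (intent (minExtent Y)) , intent (minExtent Y))
      ≡⟨ cong (λ A → extent (intent A) , intent A) minY′≡Y′ ⟩
    (extent (intent (extent Y)) , intent (extent Y))
      ≡⟨ cong (_, intent (extent Y)) (extent∘intent∘extent≡extent Y) ⟩
    (extent Y , intent (extent Y)) ∎

theorem4 : ∀ {n k : ℕ} (K : ExtContext n k) → ExtContext.Valid K →
    ∀ (C₁ C₂ : Subset _ × Subset _) →
    ExtContext.IsTypical K C₁ → ExtContext.IsTypical K C₂ →
    ExtContext.IsTypical K (ExtContext.meet K C₁ C₂)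
theorem4 {k = k} K valid _ _ (X₁ , refl) (X₂ , refl) = Y , (begin
  typicalOf Y                       ≡⟨ minExtent≡extent⇒typicalOf≡concept Y minY′≡Y′ ⟩
  (extent Y , intent (extent Y))    ≡⟨ cong (_, intent (extent Y)) (extent-∪ B₁ B₂) ⟩
  meet (typicalOf X₁) (typicalOf X₂) ∎)
  where
  open ExtContext K
  open ContextProperties K
  B₁ B₂ Y : Subset (suc k)
  B₁ = intent (minExtent X₁)
  B₂ = intent (minExtent X₂)
  Y  = B₁ ∪ B₂
  Y′⊆minX₁′ : extent Y ⊆ minExtent X₁
  Y′⊆minX₁′ = ⊆-trans (⊆-reflexive (extent-∪ B₁ B₂))
    (⊆-trans (p∩q⊆p (extent B₁) (extent B₂)) (⊆-reflexive (sym (valid X₁))))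
  minY′≡Y′ : minExtent Y ≡ extent Y
  minY′≡Y′ = extent⊆minExtent⇒minExtent≡extent X₁ Y Y′⊆minX₁′
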